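{- Let $(K_n,\Sigma)$ be a signed complete graph with $n\geq4$, and let $X(\Sigma)$ be the set of edges $vw$ of $K_n$ such that the triangle $uvw$ is even for every $u\in V(K_n)\setminus\{v,w\}$. Then every connected component of the graph on vertex set $V(K_n)$ with edge set $X(\Sigma)$ is a complete graph.
   Context: A signed graph is a pair $(G,\Sigma)$ with $\Sigma\subseteq E(G)$; edges in $\Sigma$ are odd, others even. A triangle is odd (resp. even) if it contains an odd (resp. even) number of edges of $\Sigma$. -}

module Defs where

open import Data.Nat using (ℕ)
open import Data.Fin using (Fin)
open import Data.Product using (_×_)
open import Data.Bool using (Bool; false; _xor_)
open import Relation.Binary.PropositionalEquality using (_≡_; _≢_)
open import Relation.Binary.Construct.Closure.ReflexiveTransitive using (Star)

-- A signing of the complete graph K_n on vertex set Fin n: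
-- σ v w ≡ true means the edge vw is odd (in Σ). Only the values on
-- distinct pairs matter; symmetry is required so that σ describes a set of
-- unordered edges.
record Signing (n : ℕ) : Set where
  field
    σ    : Fin n → Fin n → Bool
    symm : ∀ v w → σ v w ≡ σ w v
open Signing public

EvenTriangle : ∀ {n} → Signing n → Fin n → Fin n → Fin n → Set
EvenTriangle S u v w = ((σ S u v xor σ S v w) xor σ S u w) ≡ false

X : ∀ {n} → Signing n → Fin n → Fin n → Set
X S v w = v ≢ w × (∀ u → u ≢ v → u ≢ w → EvenTriangle S u v w)

Connected : ∀ {n} → Signing n → Fin n → Fin n → Set
Connected S = Star (X S)

-- The parity of triangle uvw is the xor of the parities of uva, uaw and vaw, since the edges
-- va, ua and aw each occur twice. So if va, aw ∈ X(Σ) and v ≠ w, every triangle uvw with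
-- u ∉ {a, v, w} is even, and so is avw because aw ∈ X(Σ): X(Σ) is transitive on distinct
-- vertices, hence each of its components is a clique.
module Submission where

open import Defs
open import Data.Nat using (ℕ; _≥_)
open import Data.Fin using (Fin; _≟_)
open import Data.Bool using (Bool; false; _xor_)
open import Data.Bool.Properties using (xor-∧-commutativeRing; xor-same; xor-identityʳ)
open import Data.Product using (_,_)
open import Algebra.Bundles using (CommutativeRing)
open import Relation.Nullary using (yes; no; contradiction)
open import Relation.Binary.PropositionalEquality
  using (_≡_; _≢_; refl; sym; trans; cong; cong₂; ≢-sym; module ≡-Reasoning)
open import Relation.Binary.Construct.Closure.ReflexiveTransitive using (ε; _◅_)

open import Algebra.Solver.CommutativeMonoid
  (CommutativeRing.+-commutativeMonoid xor-∧-commutativeRing) using (solve; _⊕_; _⊜_)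

module _ {n : ℕ} (S : Signing n) where

  triangle : Fin n → Fin n → Fin n → Bool
  triangle u v w = (σ S u v xor σ S v w) xor σ S u w

  triangle-swapˡ : ∀ u v w → triangle u v w ≡ triangle v u w
  triangle-swapˡ u v w = trans
    (solve 3 (λ x y z → (x ⊕ y) ⊕ z ⊜ (x ⊕ z) ⊕ y) refl (σ S u v) (σ S v w) (σ S u w))
    (cong (λ e → (e xor σ S u w) xor σ S v w) (symm S u v))

  triangle-swapʳ : ∀ u v w → triangle u v w ≡ triangle u w v
  triangle-swapʳ u v w = trans
    (solve 3 (λ x y z → (x ⊕ y) ⊕ z ⊜ (z ⊕ y) ⊕ x) refl (σ S u v) (σ S v w) (σ S u w))
    (cong (λ e → (σ S u w xor e) xor σ S u v) (symm S v w))

  triangle-≡-xor-triangles : ∀ u v w a →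
    triangle u v w ≡ (triangle u v a xor triangle u a w) xor triangle v a w
  triangle-≡-xor-triangles u v w a = begin
    (uv xor vw) xor uw
      ≡⟨ sym (xor-identityʳ _) ⟩
    ((uv xor vw) xor uw) xor false
      ≡⟨ cong (((uv xor vw) xor uw) xor_) (sym edges-at-a-cancel) ⟩
    ((uv xor vw) xor uw) xor ((va xor va) xor ((ua xor ua) xor (aw xor aw)))
      ≡⟨ solve 6 (λ uv vw uw va ua aw →
                   ((uv ⊕ vw) ⊕ uw) ⊕ ((va ⊕ va) ⊕ ((ua ⊕ ua) ⊕ (aw ⊕ aw))) ⊜
                   (((uv ⊕ va) ⊕ ua) ⊕ ((ua ⊕ aw) ⊕ uw)) ⊕ ((va ⊕ aw) ⊕ vw))
                 refl uv vw uw va ua aw ⟩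
    (((uv xor va) xor ua) xor ((ua xor aw) xor uw)) xor ((va xor aw) xor vw) ∎
    where
    open ≡-Reasoning
    uv = σ S u v; vw = σ S v w; uw = σ S u w
    va = σ S v a; ua = σ S u a; aw = σ S a w
    edges-at-a-cancel : (va xor va) xor ((ua xor ua) xor (aw xor aw)) ≡ false
    edges-at-a-cancel rewrite xor-same va | xor-same ua | xor-same aw = refl

  even-triangle-from-4-cycle : ∀ u v w a → EvenTriangle S u v a → EvenTriangle S u a w →
    EvenTriangle S v a w → EvenTriangle S u v w
  even-triangle-from-4-cycle u v w a uva uaw vaw = trans (triangle-≡-xor-triangles u v w a)
    (cong₂ _xor_ (cong₂ _xor_ uva uaw) vaw)

  X-trans : ∀ {v a w} → X S v a → X S a w → v ≢ w → X S v w
  X-trans {v} {a} {w} (_ , va-even) (a≢w , aw-even) v≢w = v≢w , uvw-even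
    where
    vaw-even : EvenTriangle S v a w
    vaw-even = trans (trans (triangle-swapʳ v a w) (triangle-swapˡ v w a))
                     (va-even w (≢-sym v≢w) (≢-sym a≢w))
    uvw-even : ∀ u → u ≢ v → u ≢ w → EvenTriangle S u v w
    uvw-even u u≢v u≢w with u ≟ a
    ... | yes refl = trans (triangle-swapˡ u v w) (aw-even v (≢-sym u≢v) v≢w)
    ... | no u≢a = even-triangle-from-4-cycle u v w a
                     (va-even u u≢v u≢a) (aw-even u u≢a u≢w) vaw-even

  connected⇒X : ∀ {v w} → Connected S v w → v ≢ w → X S v w
  connected⇒X ε v≢v = contradiction refl v≢v
  connected⇒X {w = w} (_◅_ {j = a} va path) v≢w with a ≟ w
  ... | yes refl = va
  ... | no a≢w = X-trans va (connected⇒X path a≢w) v≢w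

lemma3p3 : (n : ℕ) → n ≥ 4 → (S : Signing n) →
    ∀ (v w : Fin n) → Connected S v w → v ≢ w → X S v w
lemma3p3 n _ S v w c v≢w = connected⇒X S c v≢w
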